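{- Let $r\ge 1$ and let $G$ be a graph with $\Delta(G)\le r$. Let $T$ be a cluster of $G$ with $t=|T|$, let $S=\bigcap_{x\in T}N(x)$, let $R$ be the complement of $G[S]$, and let $G_T=G+\binom{S}{2}-[S,V(G)\setminus(T\cup S)]$. Then \[ k_3(G_T)-k_3(G)\ge t\cdot e(R)-2\#(R,K_3)-\#(R,P_3), \] where $\#(R,K_3)$ is the number of 3-subsets of $S$ inducing a triangle in $R$ and $\#(R,P_3)$ is the number of 3-subsets of $S$ inducing a path with two edges (a cherry) in $R$.
   Context: $k_3$ denotes the number of triangles. For an edge $xy$ of $G$, $w(xy)=|N(x)\cap N(y)|$; an edge is tight if $w(xy)=r-1$; a tight clique is a clique all of whose edges are tight; a cluster is a maximal tight clique with at least two vertices. $R$ is the graph on vertex set $S$ whose edges are the pairs in $S$ non-adjacent in $G$. $G_T$ is obtained from $G$ by making $S$ a clique and deleting all edges between $S$ and $V(G)\setminus(T\cup S)$. $e(R)$ is the number of edges of $R$. -}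

module Defs where

open import Data.Nat using (ℕ; zero; suc; _∸_)
open import Data.Bool using (Bool; true; false; _∧_; _∨_; not; if_then_else_)
open import Data.Fin using (Fin)
import Data.Fin as Fin
open import Data.List using (map; allFin)
open import Data.Nat.ListAction using (sum)
open import Data.Bool.ListAction using (and)
open import Data.Product using (_×_)
open import Relation.Nullary using (¬_)
open import Relation.Nullary.Decidable using (⌊_⌋)
open import Relation.Binary.PropositionalEquality using (_≡_)

Adj : ℕ → Set
Adj n = Fin n → Fin n → Bool

VSet : ℕ → Set
VSet n = Fin n → Bool

b2n : Bool → ℕ
b2n true  = 1
b2n false = 0

card : ∀ {n} → VSet n → ℕ
card {n} P = sum (map (λ i → b2n (P i)) (allFin n))

count2 : ∀ {n} → (Fin n → Fin n → Bool) → ℕ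
count2 {n} P = sum (map (λ i → sum (map (λ j →
  b2n (⌊ i Fin.<? j ⌋ ∧ P i j)) (allFin n))) (allFin n))

count3 : ∀ {n} → (Fin n → Fin n → Fin n → Bool) → ℕ
count3 {n} P = sum (map (λ i → sum (map (λ j → sum (map (λ k →
  b2n (⌊ i Fin.<? j ⌋ ∧ ⌊ j Fin.<? k ⌋ ∧ P i j k)) (allFin n))) (allFin n))) (allFin n))

IsSimpleGraph : ∀ {n} → Adj n → Set
IsSimpleGraph {n} G = (∀ x y → G x y ≡ G y x) × (∀ x → G x x ≡ false)

degree : ∀ {n} → Adj n → Fin n → ℕ
degree G x = card (G x)

MaxDegreeLe : ∀ {n} → Adj n → ℕ → Set
MaxDegreeLe G r = ∀ x → degree G x Data.Nat.≤ r

k3 : ∀ {n} → Adj n → ℕ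
k3 G = count3 (λ i j k → G i j ∧ G i k ∧ G j k)

w : ∀ {n} → Adj n → Fin n → Fin n → ℕ
w G x y = card (λ z → G x z ∧ G y z)

TightEdge : ∀ {n} → Adj n → ℕ → Fin n → Fin n → Set
TightEdge G r x y = (G x y ≡ true) × (w G x y ≡ r ∸ 1)

TightClique : ∀ {n} → Adj n → ℕ → VSet n → Set
TightClique G r T = ∀ x y → T x ≡ true → T y ≡ true → ¬ (x ≡ y) → TightEdge G r x y

Cluster : ∀ {n} → Adj n → ℕ → VSet n → Set
Cluster {n} G r T =
  TightClique G r T ×
  (2 Data.Nat.≤ card T) ×
  (∀ (T' : VSet n) → TightClique G r T' → (∀ x → T x ≡ true → T' x ≡ true) →
     ∀ x → T' x ≡ true → T x ≡ true)

commonNbhd : ∀ {n} → Adj n → VSet n → VSet n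
commonNbhd {n} G T v = and (map (λ y → not (T y) ∨ G y v) (allFin n))

Rgraph : ∀ {n} → Adj n → VSet n → Adj n
Rgraph G S x y = S x ∧ S y ∧ not ⌊ x Fin.≟ y ⌋ ∧ not (G x y)

GT : ∀ {n} → Adj n → VSet n → Adj n
GT G T x y =
  if S x ∧ S y ∧ not ⌊ x Fin.≟ y ⌋ then true
  else if (S x ∧ not (T y ∨ S y)) ∨ (S y ∧ not (T x ∨ S x)) then false
  else G x y
  where S = commonNbhd G T

eR : ∀ {n} → Adj n → ℕ
eR R = count2 R

numK3 : ∀ {n} → Adj n → ℕ
numK3 R = count3 (λ i j k → R i j ∧ R i k ∧ R j k)

numP3 : ∀ {n} → Adj n → ℕ
numP3 R = count3 (λ i j k →
  (R i j ∧ R i k ∧ not (R j k)) ∨ (R i j ∧ not (R i k) ∧ R j k) ∨ (not (R i j) ∧ R i k ∧ R j k))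

module Submission where

-- We count over ordered triples of distinct vertices.  As the edges of T are tight and Δ(G) ≤ r,
-- every neighbour of a vertex of T lies in T ∪ S, and |T| + |S| ≥ r + 1.  Hence the new triangles
-- of G_T are the xab with x ∈ T, ab ∈ R, and the 3-subsets of S spanning an edge of R; counting the
-- latter through their R-edges gives at least (|S| − 2)·e(R) − 2#(R,K₃) − #(R,P₃) of them.  A lost
-- triangle contains an edge ab with a ∈ S, b ∉ T ∪ S, and in fact two paths bac of this kind with
-- c ∉ T.  A vertex a ∈ S has at most deg_R(a) neighbours outside T ∪ S, and at most |S| − 2
-- neighbours outside T besides b, so at most (|S| − 2)·e(R) triangles are lost.  What is checked
-- about a single triple only involves nine bits (memberships in T and S, adjacencies in G) and is
-- verified by exhaustion.

open import Data.Bool using (Bool; true; false; _∧_; _∨_; not; if_then_else_) renaming (T to True)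
import Data.Bool as Bool
open import Data.Bool.Properties using (∧-comm; ∧-assoc; ∧-zeroʳ; T-≡)
open import Data.Fin using (Fin; zero; suc; _<?_)
open import Data.Fin.Properties using (_≟_; suc-injective; <-cmp; <-trans; any?)
open import Data.List using (map; allFin; tabulate)
open import Data.List.Properties using (map-tabulate)
open import Data.List.Relation.Unary.All.Properties using (all⁺; all⁻; tabulate⁺; tabulate⁻)
open import Data.Nat using (ℕ; zero; suc; _∸_; _≤_; _≤ᵇ_; _≡ᵇ_; z≤n; s≤s)
import Data.Nat as ℕ
import Data.Nat.ListAction as List
open import Data.Nat.Properties
  using (+-*-semiring; module ≤-Reasoning; ≤-trans; ≤-reflexive; ≤ᵇ⇒≤; ≡ᵇ⇒≡; 1+n≰n; m≤n+m;
         m∸n+n≡m; m≤n+o⇒m∸n≤o; m+n≤o⇒m≤o∸n; +-identityʳ; +-assoc; +-comm; *-assoc; *-zeroʳ; *-distribˡ-+;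
         +-mono-≤; +-monoˡ-≤; +-monoʳ-≤; *-monoˡ-≤; *-monoʳ-≤; +-cancelʳ-≤; *-cancelˡ-≤)
open import Data.Product using (_×_; _,_; proj₁; proj₂; ∃)
open import Algebra.Properties.Semiring.Sum +-*-semiring
  using (sum; sum-syntax; sum-cong-≗; sum-replicate-zero; ∑-distrib-+; ∑-comm; *-distribˡ-sum; *-distribʳ-sum)
open import Function using (_∘_; id)
open import Function.Bundles using (Equivalence)
open import Relation.Binary using (tri<; tri≈; tri>)
open import Relation.Binary.PropositionalEquality
open import Relation.Nullary using (Dec; yes; no; ¬_; contradiction; _×-dec_; ¬?)
open import Relation.Nullary.Decidable using (⌊_⌋; ⌊⌋-map′; isYes≗does; dec-true; dec-false)

open import Defs

module BooleanChecks where

  open import Data.Nat using (_+_; _*_)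

  _⇒ᵇ_ : Bool → Bool → Bool
  a ⇒ᵇ b = not a ∨ b

  ∧-intro : ∀ {a b} → a ≡ true → b ≡ true → a ∧ b ≡ true
  ∧-intro refl refl = refl

  ∧-elim : ∀ {a b} → a ∧ b ≡ true → a ≡ true × b ≡ true
  ∧-elim {true} {true} _ = refl , refl

  ⇒ᵇ-intro : ∀ {a b} → (a ≡ true → b ≡ true) → a ⇒ᵇ b ≡ true
  ⇒ᵇ-intro {false} _ = refl
  ⇒ᵇ-intro {true}  f = f refl

  ⇒ᵇ-elim : ∀ {a b} → a ⇒ᵇ b ≡ true → a ≡ true → b ≡ true
  ⇒ᵇ-elim h refl = h

  not-true : ∀ {a} → not a ≡ true → a ≡ false
  not-true {false} _ = refl

  ≤ᵇ-sound : ∀ {m n} → (m ≤ᵇ n) ≡ true → m ≤ n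
  ≤ᵇ-sound {m} {n} h = ≤ᵇ⇒≤ m n (subst True (sym h) _)

  ≡ᵇ-sound : ∀ {m n} → (m ≡ᵇ n) ≡ true → m ≡ n
  ≡ᵇ-sound {m} {n} h = ≡ᵇ⇒≡ m n (subst True (sym h) _)

  ∧-swapˡ : ∀ a b c → a ∧ (b ∧ c) ≡ b ∧ (a ∧ c)
  ∧-swapˡ a b c = trans (sym (∧-assoc a b c)) (trans (cong (_∧ c) (∧-comm a b)) (∧-assoc b a c))

  module _ {a} {A : Set a} where

    ⌊⌋-true : (A? : Dec A) → A → ⌊ A? ⌋ ≡ true
    ⌊⌋-true A? x = trans (isYes≗does A?) (dec-true A? x)

    ⌊⌋-false : (A? : Dec A) → ¬ A → ⌊ A? ⌋ ≡ false
    ⌊⌋-false A? ¬x = trans (isYes≗does A?) (dec-false A? ¬x)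

    ⌊⌋-witness : (A? : Dec A) → ⌊ A? ⌋ ≡ true → A
    ⌊⌋-witness (yes x) _ = x

    ⌊⌋-refutation : (A? : Dec A) → ⌊ A? ⌋ ≡ false → ¬ A
    ⌊⌋-refutation (no ¬x) _ = ¬x

  b2n-∧ : ∀ a b → b2n (a ∧ b) ≡ b2n a * b2n b
  b2n-∧ false b = refl
  b2n-∧ true  b = sym (+-identityʳ (b2n b))

  b2n-*-≤ : ∀ a {x y} → (a ≡ true → x ≤ y) → b2n a * x ≤ y
  b2n-*-≤ false _   = z≤n
  b2n-*-≤ true  x≤y = ≤-trans (≤-reflexive (+-identityʳ _)) (x≤y refl)

  b2n≤1 : ∀ a → b2n a ≤ 1
  b2n≤1 false = z≤n
  b2n≤1 true  = s≤s z≤n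

  b2n-∧-≤ˡ : ∀ a b → b2n (a ∧ b) ≤ b2n a
  b2n-∧-≤ˡ false b = z≤n
  b2n-∧-≤ˡ true  b = b2n≤1 b

  b2n-∨ : ∀ a b → a ∨ b ≡ true → 1 ≤ b2n a + b2n b
  b2n-∨ true  b     _ = s≤s z≤n
  b2n-∨ false true  _ = s≤s z≤n

  BoolPred : ℕ → Set
  BoolPred zero    = Bool
  BoolPred (suc n) = Bool → BoolPred n

  Valid : ∀ n → BoolPred n → Set
  Valid zero    b = b ≡ true
  Valid (suc n) p = ∀ b → Valid n (p b)

  checkAll : ∀ n → BoolPred n → Bool
  checkAll zero    b = b
  checkAll (suc n) p = checkAll n (p true) ∧ checkAll n (p false)

  checkAll-sound : ∀ n (p : BoolPred n) → checkAll n p ≡ true → Valid n p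
  checkAll-sound zero    b h       = h
  checkAll-sound (suc n) p h true  = checkAll-sound n (p true) (proj₁ (∧-elim h))
  checkAll-sound (suc n) p h false = checkAll-sound n (p false) (proj₂ (∧-elim {checkAll n (p true)} h))

  sameᵇ : ∀ n → BoolPred n → BoolPred n → BoolPred n
  sameᵇ zero    a b = ⌊ a Bool.≟ b ⌋
  sameᵇ (suc n) f g = λ x → sameᵇ n (f x) (g x)

module FiniteSums where

  open import Data.Nat using (_+_; _*_)
  open import Data.Nat.Tactic.RingSolver using (solve-∀)

  open BooleanChecks

  listSum-allFin : ∀ {n} (f : Fin n → ℕ) → List.sum (map f (allFin n)) ≡ sum f
  listSum-allFin f = trans (cong List.sum (map-tabulate id f)) (tabulate-sum f)
    where
    tabulate-sum : ∀ {n} (f : Fin n → ℕ) → List.sum (tabulate f) ≡ sum f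
    tabulate-sum {zero}  f = refl
    tabulate-sum {suc n} f = cong (f zero +_) (tabulate-sum (f ∘ suc))

  ∑-mono-≤ : ∀ {n} {f g : Fin n → ℕ} → (∀ i → f i ≤ g i) → sum f ≤ sum g
  ∑-mono-≤ {zero}  f≤g = z≤n
  ∑-mono-≤ {suc n} f≤g = +-mono-≤ (f≤g zero) (∑-mono-≤ (f≤g ∘ suc))

  ∑-indicator : ∀ {n} (i : Fin n) → ∑[ k < n ] b2n ⌊ k ≟ i ⌋ ≡ 1
  ∑-indicator {suc n} zero    = cong suc (sum-replicate-zero n)
  ∑-indicator {suc n} (suc i) =
    trans (sum-cong-≗ (λ k → cong b2n (⌊⌋-map′ (cong suc) suc-injective (k ≟ i)))) (∑-indicator i)

  ∑-+-indicator : ∀ {n} (f : Fin n → ℕ) (i : Fin n) → ∑[ k < n ] (f k + b2n ⌊ k ≟ i ⌋) ≡ sum f + 1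
  ∑-+-indicator f i = trans (∑-distrib-+ f λ k → b2n ⌊ k ≟ i ⌋) (cong (sum f +_) (∑-indicator i))

  card≡∑ : ∀ {n} (P : VSet n) → card P ≡ ∑[ i < n ] b2n (P i)
  card≡∑ P = listSum-allFin λ i → b2n (P i)

  card-mono : ∀ {n} {P Q : VSet n} → (∀ i → P i ≡ true → Q i ≡ true) → card P ≤ card Q
  card-mono {n} {P} {Q} P⊆Q = begin
    card P
      ≡⟨ card≡∑ P ⟩
    ∑[ i < n ] b2n (P i)
      ≤⟨ ∑-mono-≤ pointwise ⟩
    ∑[ i < n ] b2n (Q i)
      ≡⟨ card≡∑ Q ⟨
    card Q ∎
    where
    open ≤-Reasoning
    pointwise : ∀ i → b2n (P i) ≤ b2n (Q i)
    pointwise i with P i in Pi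
    ... | false = z≤n
    ... | true  rewrite P⊆Q i Pi = s≤s z≤n

  card-singleton : ∀ {n} (i : Fin n) → card (λ k → ⌊ k ≟ i ⌋) ≡ 1
  card-singleton i = trans (card≡∑ λ k → ⌊ k ≟ i ⌋) (∑-indicator i)

  card-empty : ∀ n → card {n} (λ _ → false) ≡ 0
  card-empty n = trans (card≡∑ {n} λ _ → false) (sum-replicate-zero n)

  member : ∀ {n} (P : VSet n) → 1 ≤ card P → ∃ λ x → P x ≡ true
  member {n} P 1≤|P| with any? (λ x → P x Bool.≟ true)
  ... | yes found = found
  ... | no  none  =
    contradiction (≤-trans 1≤|P| (≤-trans (card-mono empty) (≤-reflexive (card-empty n)))) λ ()
    where
    empty : ∀ x → P x ≡ true → false ≡ true
    empty x Px = contradiction (x , Px) none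

  other-member : ∀ {n} (P : VSet n) (x : Fin n) → 2 ≤ card P → ∃ λ y → P y ≡ true × x ≢ y
  other-member P x 2≤|P| with any? (λ y → (P y Bool.≟ true) ×-dec ¬? (x ≟ y))
  ... | yes found = found
  ... | no  none  =
    contradiction (≤-trans 2≤|P| (≤-trans (card-mono onlyX) (≤-reflexive (card-singleton x)))) λ { (s≤s ()) }
    where
    onlyX : ∀ y → P y ≡ true → ⌊ y ≟ x ⌋ ≡ true
    onlyX y Py with y ≟ x
    ... | yes _   = refl
    ... | no  y≢x = contradiction (y , Py , y≢x ∘ sym) none

  Σ₃ : ∀ {n} → (Fin n → Fin n → Fin n → ℕ) → ℕ
  Σ₃ {n} f = ∑[ i < n ] ∑[ j < n ] ∑[ k < n ] f i j k

  module _ {n : ℕ} where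

    Σ₃-cong : {f g : Fin n → Fin n → Fin n → ℕ} → (∀ i j k → f i j k ≡ g i j k) → Σ₃ f ≡ Σ₃ g
    Σ₃-cong f≡g = sum-cong-≗ λ i → sum-cong-≗ λ j → sum-cong-≗ λ k → f≡g i j k

    Σ₃-mono-≤ : {f g : Fin n → Fin n → Fin n → ℕ} → (∀ i j k → f i j k ≤ g i j k) → Σ₃ f ≤ Σ₃ g
    Σ₃-mono-≤ f≤g = ∑-mono-≤ λ i → ∑-mono-≤ λ j → ∑-mono-≤ λ k → f≤g i j k

    Σ₃-distrib-+ : (f g : Fin n → Fin n → Fin n → ℕ) → Σ₃ (λ i j k → f i j k + g i j k) ≡ Σ₃ f + Σ₃ g
    Σ₃-distrib-+ f g = begin
      Σ₃ (λ i j k → f i j k + g i j k)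
        ≡⟨ sum-cong-≗ (λ i → sum-cong-≗ λ j → ∑-distrib-+ (f i j) (g i j)) ⟩
      ∑[ i < n ] ∑[ j < n ] (∑[ k < n ] f i j k + ∑[ k < n ] g i j k)
        ≡⟨ sum-cong-≗ (λ i → ∑-distrib-+ (λ j → ∑[ k < n ] f i j k) (λ j → ∑[ k < n ] g i j k)) ⟩
      ∑[ i < n ] (∑[ j < n ] ∑[ k < n ] f i j k + ∑[ j < n ] ∑[ k < n ] g i j k)
        ≡⟨ ∑-distrib-+ (λ i → ∑[ j < n ] ∑[ k < n ] f i j k) (λ i → ∑[ j < n ] ∑[ k < n ] g i j k) ⟩
      Σ₃ f + Σ₃ g ∎
      where open ≡-Reasoning

    Σ₃-swap₁₂ : (f : Fin n → Fin n → Fin n → ℕ) → Σ₃ (λ i j k → f j i k) ≡ Σ₃ f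
    Σ₃-swap₁₂ f = ∑-comm (λ i j → ∑[ k < n ] f j i k)

    Σ₃-swap₂₃ : (f : Fin n → Fin n → Fin n → ℕ) → Σ₃ (λ i j k → f i k j) ≡ Σ₃ f
    Σ₃-swap₂₃ f = sum-cong-≗ λ i → ∑-comm (λ j k → f i k j)

  Σ₃-separate : ∀ {n} (a : Fin n → ℕ) (b : Fin n → Fin n → ℕ) →
                Σ₃ (λ i j k → a i * b j k) ≡ sum a * ∑[ j < n ] ∑[ k < n ] b j k
  Σ₃-separate {n} a b = trans
    (sum-cong-≗ λ i → trans (sum-cong-≗ λ j → sym (*-distribˡ-sum (a i) (b j)))
                            (sym (*-distribˡ-sum (a i) λ j → ∑[ k < n ] b j k)))
    (sym (*-distribʳ-sum (∑[ j < n ] ∑[ k < n ] b j k) a))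

  ⌊≟⌋-sym : ∀ {n} (i j : Fin n) → ⌊ i ≟ j ⌋ ≡ ⌊ j ≟ i ⌋
  ⌊≟⌋-sym i j with i ≟ j
  ... | yes refl = sym (⌊⌋-true (i ≟ i) refl)
  ... | no  i≢j  = sym (⌊⌋-false (j ≟ i) (i≢j ∘ sym))

  distinct : ∀ {n} → Fin n → Fin n → Fin n → Bool
  distinct i j k = not ⌊ i ≟ j ⌋ ∧ not ⌊ i ≟ k ⌋ ∧ not ⌊ j ≟ k ⌋

  distinct-swap₁₂ : ∀ {n} (i j k : Fin n) → distinct j i k ≡ distinct i j k
  distinct-swap₁₂ i j k rewrite ⌊≟⌋-sym j i = cong (not ⌊ i ≟ j ⌋ ∧_) (∧-comm (not ⌊ j ≟ k ⌋) (not ⌊ i ≟ k ⌋))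

  distinct-swap₂₃ : ∀ {n} (i j k : Fin n) → distinct i k j ≡ distinct i j k
  distinct-swap₂₃ i j k rewrite ⌊≟⌋-sym k j = ∧-swapˡ (not ⌊ i ≟ k ⌋) (not ⌊ i ≟ j ⌋) (not ⌊ j ≟ k ⌋)

  distinct-intro : ∀ {n} {i j k : Fin n} → i ≢ j → i ≢ k → j ≢ k → distinct i j k ≡ true
  distinct-intro {i = i} {j} {k} i≢j i≢k j≢k
    rewrite ⌊⌋-false (i ≟ j) i≢j | ⌊⌋-false (i ≟ k) i≢k | ⌊⌋-false (j ≟ k) j≢k = refl

  distinct-elim : ∀ {n} (i j k : Fin n) → distinct i j k ≡ true → i ≢ j × i ≢ k × j ≢ k
  distinct-elim i j k d =
    let i≠j , rest = ∧-elim {not ⌊ i ≟ j ⌋} d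
        i≠k , j≠k  = ∧-elim {not ⌊ i ≟ k ⌋} rest
    in ⌊⌋-refutation (i ≟ j) (not-true i≠j) ,
       ⌊⌋-refutation (i ≟ k) (not-true i≠k) ,
       ⌊⌋-refutation (j ≟ k) (not-true j≠k)

  ∑-distinct-≥ : ∀ {n} (P : VSet n) {i j : Fin n} → i ≢ j →
                 card P ∸ 2 ≤ ∑[ k < n ] (b2n (distinct i j k) * b2n (P k))
  ∑-distinct-≥ {n} P {i} {j} i≢j = m≤n+2⇒m∸2≤n (begin
    card P
      ≡⟨ card≡∑ P ⟩
    ∑[ k < n ] b2n (P k)
      ≤⟨ ∑-mono-≤ pointwise ⟩
    ∑[ k < n ] (restricted k + b2n ⌊ k ≟ i ⌋ + b2n ⌊ k ≟ j ⌋)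
      ≡⟨ ∑-+-indicator (λ k → restricted k + b2n ⌊ k ≟ i ⌋) j ⟩
    ∑[ k < n ] (restricted k + b2n ⌊ k ≟ i ⌋) + 1
      ≡⟨ cong (_+ 1) (∑-+-indicator restricted i) ⟩
    sum restricted + 1 + 1
      ≡⟨ +-assoc (sum restricted) 1 1 ⟩
    sum restricted + 2 ∎)
    where
    open ≤-Reasoning
    restricted : Fin n → ℕ
    restricted k = b2n (distinct i j k) * b2n (P k)
    m≤n+2⇒m∸2≤n : ∀ {m n} → m ≤ n + 2 → m ∸ 2 ≤ n
    m≤n+2⇒m∸2≤n {m} {n} h = m≤n+o⇒m∸n≤o m 2 (subst (m ≤_) (+-comm n 2) h)
    pointwise : ∀ k → b2n (P k) ≤ restricted k + b2n ⌊ k ≟ i ⌋ + b2n ⌊ k ≟ j ⌋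
    pointwise k rewrite ⌊⌋-false (i ≟ j) i≢j | ⌊≟⌋-sym i k | ⌊≟⌋-sym j k with k ≟ i | k ≟ j
    ... | yes _ | _     = ≤-trans (b2n≤1 (P k)) (s≤s z≤n)
    ... | no _  | yes _ = b2n≤1 (P k)
    ... | no _  | no _  = ≤-reflexive (sym (zeros (b2n (P k))))
      where
      zeros : ∀ m → m + 0 + 0 + 0 ≡ m
      zeros = solve-∀


  Σ≠ : ∀ {n} → (Fin n → Fin n → Fin n → ℕ) → ℕ
  Σ≠ f = Σ₃ λ i j k → b2n (distinct i j k) * f i j k

  module _ {n : ℕ} where

    Σ≠-mono-≤ : {f g : Fin n → Fin n → Fin n → ℕ} → (∀ i j k → f i j k ≤ g i j k) → Σ≠ f ≤ Σ≠ g
    Σ≠-mono-≤ f≤g = Σ₃-mono-≤ λ i j k → *-monoʳ-≤ (b2n (distinct i j k)) (f≤g i j k)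

    Σ≠-cong : {f g : Fin n → Fin n → Fin n → ℕ} →
              (∀ i j k → distinct i j k ≡ true → f i j k ≡ g i j k) → Σ≠ f ≡ Σ≠ g
    Σ≠-cong {f} {g} f≡g = Σ₃-cong restricted
      where
      restricted : ∀ i j k → b2n (distinct i j k) * f i j k ≡ b2n (distinct i j k) * g i j k
      restricted i j k with distinct i j k in d
      ... | true  = cong (_+ 0) (f≡g i j k d)
      ... | false = refl

    Σ≠-distrib-+ : (f g : Fin n → Fin n → Fin n → ℕ) → Σ≠ (λ i j k → f i j k + g i j k) ≡ Σ≠ f + Σ≠ g
    Σ≠-distrib-+ f g = trans (Σ₃-cong λ i j k → *-distribˡ-+ (b2n (distinct i j k)) (f i j k) (g i j k))
                             (Σ₃-distrib-+ (λ i j k → b2n (distinct i j k) * f i j k)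
                                           (λ i j k → b2n (distinct i j k) * g i j k))

    Σ≠-swap₁₂ : (f : Fin n → Fin n → Fin n → ℕ) → Σ≠ (λ i j k → f j i k) ≡ Σ≠ f
    Σ≠-swap₁₂ f = trans (Σ₃-cong λ i j k → cong (λ d → b2n d * f j i k) (sym (distinct-swap₁₂ i j k)))
                        (Σ₃-swap₁₂ λ i j k → b2n (distinct i j k) * f i j k)

    Σ≠-swap₂₃ : (f : Fin n → Fin n → Fin n → ℕ) → Σ≠ (λ i j k → f i k j) ≡ Σ≠ f
    Σ≠-swap₂₃ f = trans (Σ₃-cong λ i j k → cong (λ d → b2n d * f i k j) (sym (distinct-swap₂₃ i j k)))
                        (Σ₃-swap₂₃ λ i j k → b2n (distinct i j k) * f i j k)

  module PermutationInvariance {n : ℕ} (Σ : (Fin n → Fin n → Fin n → ℕ) → ℕ)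
    (swap₁₂ : ∀ f → Σ (λ i j k → f j i k) ≡ Σ f)
    (swap₂₃ : ∀ f → Σ (λ i j k → f i k j) ≡ Σ f)
    (distrib-+ : ∀ f g → Σ (λ i j k → f i j k + g i j k) ≡ Σ f + Σ g) where

    rotate² : ∀ f → Σ (λ i j k → f k i j) ≡ Σ f
    rotate² f = trans (swap₂₃ λ i j k → f j i k) (swap₁₂ f)

    orbit₃ : ∀ f → Σ (λ i j k → f i j k + f j i k + f k i j) ≡ 3 * Σ f
    orbit₃ f = begin
      Σ (λ i j k → f i j k + f j i k + f k i j)
        ≡⟨ distrib-+ (λ i j k → f i j k + f j i k) (λ i j k → f k i j) ⟩
      Σ (λ i j k → f i j k + f j i k) + Σ (λ i j k → f k i j)
        ≡⟨ cong₂ _+_ (trans (distrib-+ f λ i j k → f j i k) (cong (Σ f +_) (swap₁₂ f))) (rotate² f) ⟩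
      Σ f + Σ f + Σ f
        ≡⟨ thrice (Σ f) ⟩
      3 * Σ f ∎
      where
      open ≡-Reasoning
      thrice : ∀ x → x + x + x ≡ 3 * x
      thrice = solve-∀

    orbit₆ : ∀ f → Σ (λ i j k → (f i j k + f j i k + f k i j) + (f i k j + f j k i + f k j i)) ≡ 6 * Σ f
    orbit₆ f = begin
      Σ (λ i j k → (f i j k + f j i k + f k i j) + (f i k j + f j k i + f k j i))
        ≡⟨ distrib-+ (λ i j k → f i j k + f j i k + f k i j) (λ i j k → f i k j + f j k i + f k j i) ⟩
      Σ (λ i j k → f i j k + f j i k + f k i j) + Σ (λ i j k → f i k j + f j k i + f k j i)
        ≡⟨ cong₂ _+_ (orbit₃ f) (trans (orbit₃ λ i j k → f i k j) (cong (3 *_) (swap₂₃ f))) ⟩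
      3 * Σ f + 3 * Σ f
        ≡⟨ double (Σ f) ⟩
      6 * Σ f ∎
      where
      open ≡-Reasoning
      double : ∀ x → 3 * x + 3 * x ≡ 6 * x
      double = solve-∀

  module Σ₃-Invariance {n : ℕ} = PermutationInvariance {n} Σ₃ Σ₃-swap₁₂ Σ₃-swap₂₃ Σ₃-distrib-+
  module Σ≠-Invariance {n : ℕ} = PermutationInvariance {n} Σ≠ Σ≠-swap₁₂ Σ≠-swap₂₃ Σ≠-distrib-+

  count3≡Σ₃ : ∀ {n} (P : Fin n → Fin n → Fin n → Bool) →
              count3 P ≡ Σ₃ (λ i j k → b2n (⌊ i <? j ⌋ ∧ ⌊ j <? k ⌋ ∧ P i j k))
  count3≡Σ₃ {n} P =
    trans (listSum-allFin λ i → List.sum (map (λ j → List.sum (map (f i j) (allFin n))) (allFin n)))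
          (sum-cong-≗ λ i → trans (listSum-allFin λ j → List.sum (map (f i j) (allFin n)))
                                  (sum-cong-≗ λ j → listSum-allFin (f i j)))
    where
    f : Fin n → Fin n → Fin n → ℕ
    f i j k = b2n (⌊ i <? j ⌋ ∧ ⌊ j <? k ⌋ ∧ P i j k)

  trichotomousᵇ : Bool → Bool → Bool → Bool
  trichotomousᵇ lt gt eq = (lt ∧ not gt ∧ not eq) ∨ (not lt ∧ gt ∧ not eq) ∨ (not lt ∧ not gt ∧ eq)

  strictTotalOrderᵇ : (lᵢⱼ lⱼᵢ lᵢₖ lₖᵢ lⱼₖ lₖⱼ eᵢⱼ eᵢₖ eⱼₖ : Bool) → Bool
  strictTotalOrderᵇ lᵢⱼ lⱼᵢ lᵢₖ lₖᵢ lⱼₖ lₖⱼ eᵢⱼ eᵢₖ eⱼₖ =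
    trichotomousᵇ lᵢⱼ lⱼᵢ eᵢⱼ ∧ trichotomousᵇ lᵢₖ lₖᵢ eᵢₖ ∧ trichotomousᵇ lⱼₖ lₖⱼ eⱼₖ ∧
    ((lᵢⱼ ∧ lⱼₖ) ⇒ᵇ lᵢₖ) ∧ ((lᵢₖ ∧ lₖⱼ) ⇒ᵇ lᵢⱼ) ∧ ((lⱼᵢ ∧ lᵢₖ) ⇒ᵇ lⱼₖ) ∧
    ((lⱼₖ ∧ lₖᵢ) ⇒ᵇ lⱼᵢ) ∧ ((lₖᵢ ∧ lᵢⱼ) ⇒ᵇ lₖⱼ) ∧ ((lₖⱼ ∧ lⱼᵢ) ⇒ᵇ lₖᵢ)

  -- Three distinct points are in exactly one of six orders.
  sixOrdersᵇ : BoolPred 10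
  sixOrdersᵇ lᵢⱼ lⱼᵢ lᵢₖ lₖᵢ lⱼₖ lₖⱼ eᵢⱼ eᵢₖ eⱼₖ p =
    strictTotalOrderᵇ lᵢⱼ lⱼᵢ lᵢₖ lₖᵢ lⱼₖ lₖⱼ eᵢⱼ eᵢₖ eⱼₖ ⇒ᵇ
    (b2n (not eᵢⱼ ∧ not eᵢₖ ∧ not eⱼₖ) * b2n p ≡ᵇ
       (b2n (lᵢⱼ ∧ lⱼₖ ∧ p) + b2n (lⱼᵢ ∧ lᵢₖ ∧ p) + b2n (lₖᵢ ∧ lᵢⱼ ∧ p)) +
       (b2n (lᵢₖ ∧ lₖⱼ ∧ p) + b2n (lⱼₖ ∧ lₖᵢ ∧ p) + b2n (lₖⱼ ∧ lⱼᵢ ∧ p)))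

  module _ {n : ℕ} where

    trichotomous-<? : (i j : Fin n) → trichotomousᵇ ⌊ i <? j ⌋ ⌊ j <? i ⌋ ⌊ i ≟ j ⌋ ≡ true
    trichotomous-<? i j with <-cmp i j
    ... | tri< i<j i≢j j≮i rewrite ⌊⌋-true (i <? j) i<j | ⌊⌋-false (j <? i) j≮i | ⌊⌋-false (i ≟ j) i≢j = refl
    ... | tri≈ i≮j i≡j j≮i rewrite ⌊⌋-false (i <? j) i≮j | ⌊⌋-false (j <? i) j≮i | ⌊⌋-true (i ≟ j) i≡j = refl
    ... | tri> i≮j i≢j j<i rewrite ⌊⌋-false (i <? j) i≮j | ⌊⌋-true (j <? i) j<i | ⌊⌋-false (i ≟ j) i≢j = refl

    transitive-<? : (i j k : Fin n) → (⌊ i <? j ⌋ ∧ ⌊ j <? k ⌋) ⇒ᵇ ⌊ i <? k ⌋ ≡ true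
    transitive-<? i j k = ⇒ᵇ-intro λ h →
      ⌊⌋-true (i <? k) (<-trans (⌊⌋-witness (i <? j) (proj₁ (∧-elim h)))
                                (⌊⌋-witness (j <? k) (proj₂ (∧-elim h))))

    strictTotalOrder-<? : (i j k : Fin n) →
      strictTotalOrderᵇ ⌊ i <? j ⌋ ⌊ j <? i ⌋ ⌊ i <? k ⌋ ⌊ k <? i ⌋ ⌊ j <? k ⌋ ⌊ k <? j ⌋
                        ⌊ i ≟ j ⌋ ⌊ i ≟ k ⌋ ⌊ j ≟ k ⌋ ≡ true
    strictTotalOrder-<? i j k =
      ∧-intro (trichotomous-<? i j) (∧-intro (trichotomous-<? i k) (∧-intro (trichotomous-<? j k)
      (∧-intro (transitive-<? i j k) (∧-intro (transitive-<? i k j) (∧-intro (transitive-<? j i k)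
      (∧-intro (transitive-<? j k i) (∧-intro (transitive-<? k i j) (transitive-<? k j i))))))))

  Symmetric₃ : ∀ {n} → (Fin n → Fin n → Fin n → Bool) → Set
  Symmetric₃ P = (∀ i j k → P j i k ≡ P i j k) × (∀ i j k → P i k j ≡ P i j k)

  Σ≠-count3 : ∀ {n} (P : Fin n → Fin n → Fin n → Bool) → Symmetric₃ P →
              Σ≠ (λ i j k → b2n (P i j k)) ≡ 6 * count3 P
  Σ≠-count3 {n} P (swap₁₂ , swap₂₃) = begin
    Σ≠ (λ i j k → b2n (P i j k))
      ≡⟨ Σ₃-cong byOrder ⟩
    Σ₃ (λ i j k → (asc i j k + asc j i k + asc k i j) + (asc i k j + asc j k i + asc k j i))
      ≡⟨ Σ₃-Invariance.orbit₆ asc ⟩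
    6 * Σ₃ asc
      ≡⟨ cong (6 *_) (sym (count3≡Σ₃ P)) ⟩
    6 * count3 P ∎
    where
    open ≡-Reasoning
    asc : Fin n → Fin n → Fin n → ℕ
    asc i j k = b2n (⌊ i <? j ⌋ ∧ ⌊ j <? k ⌋ ∧ P i j k)
    byOrder : ∀ i j k → b2n (distinct i j k) * b2n (P i j k) ≡
              (asc i j k + asc j i k + asc k i j) + (asc i k j + asc j k i + asc k j i)
    byOrder i j k rewrite swap₁₂ j k i | swap₁₂ i k j | swap₂₃ j i k | swap₂₃ i j k | swap₁₂ i j k =
      ≡ᵇ-sound (⇒ᵇ-elim (checkAll-sound 10 sixOrdersᵇ refl
                           ⌊ i <? j ⌋ ⌊ j <? i ⌋ ⌊ i <? k ⌋ ⌊ k <? i ⌋ ⌊ j <? k ⌋ ⌊ k <? j ⌋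
                           ⌊ i ≟ j ⌋ ⌊ i ≟ k ⌋ ⌊ j ≟ k ⌋ (P i j k))
                        (strictTotalOrder-<? i j k))

  count2≡∑ : ∀ {n} (R : Fin n → Fin n → Bool) → count2 R ≡ ∑[ i < n ] ∑[ j < n ] b2n (⌊ i <? j ⌋ ∧ R i j)
  count2≡∑ {n} R = trans (listSum-allFin λ i → List.sum (map (f i) (allFin n)))
                         (sum-cong-≗ λ i → listSum-allFin (f i))
    where
    f : Fin n → Fin n → ℕ
    f i j = b2n (⌊ i <? j ⌋ ∧ R i j)

  Symmetric₂ : ∀ {n} → (Fin n → Fin n → Bool) → Set
  Symmetric₂ R = ∀ x y → R y x ≡ R x y

  ∑∑-count2 : ∀ {n} (R : Fin n → Fin n → Bool) → Symmetric₂ R → (∀ x → R x x ≡ false) →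
              ∑[ i < n ] ∑[ j < n ] b2n (R i j) ≡ 2 * count2 R
  ∑∑-count2 {n} R R-sym R-irrefl = begin
    ∑[ i < n ] ∑[ j < n ] b2n (R i j)
      ≡⟨ sum-cong-≗ (λ i → sum-cong-≗ (byOrder i)) ⟩
    ∑[ i < n ] ∑[ j < n ] (up i j + up j i)
      ≡⟨ sum-cong-≗ (λ i → ∑-distrib-+ (up i) (λ j → up j i)) ⟩
    ∑[ i < n ] (∑[ j < n ] up i j + ∑[ j < n ] up j i)
      ≡⟨ ∑-distrib-+ (λ i → ∑[ j < n ] up i j) (λ i → ∑[ j < n ] up j i) ⟩
    ∑[ i < n ] ∑[ j < n ] up i j + ∑[ i < n ] ∑[ j < n ] up j i
      ≡⟨ cong (∑[ i < n ] ∑[ j < n ] up i j +_) (∑-comm (λ i j → up j i)) ⟩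
    ∑[ i < n ] ∑[ j < n ] up i j + ∑[ i < n ] ∑[ j < n ] up i j
      ≡⟨ cong₂ _+_ (sym (count2≡∑ R)) (trans (sym (count2≡∑ R)) (sym (+-identityʳ (count2 R)))) ⟩
    2 * count2 R ∎
    where
    open ≡-Reasoning
    up : Fin n → Fin n → ℕ
    up i j = b2n (⌊ i <? j ⌋ ∧ R i j)
    byOrder : ∀ i j → b2n (R i j) ≡ up i j + up j i
    byOrder i j with <-cmp i j
    ... | tri< i<j _ j≮i rewrite ⌊⌋-true (i <? j) i<j | ⌊⌋-false (j <? i) j≮i = sym (+-identityʳ _)
    ... | tri≈ i≮j refl _ rewrite ⌊⌋-false (i <? i) i≮j | R-irrefl i = refl
    ... | tri> i≮j _ j<i rewrite ⌊⌋-false (i <? j) i≮j | ⌊⌋-true (j <? i) j<i | R-sym i j = refl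

module TripleConfigurations where

  open import Data.Nat using (_+_; _*_)

  open BooleanChecks
  open FiniteSums

  -- Adjacency of x and y in R and in G_T, read off from x ∈ S, y ∈ S, x ∈ T, y ∈ T, x ≡ y and xy ∈ G.
  nonAdjacentᵇ : (sx sy exy gxy : Bool) → Bool
  nonAdjacentᵇ sx sy exy gxy = sx ∧ sy ∧ not exy ∧ not gxy

  completedᵇ : (sx sy tx ty exy gxy : Bool) → Bool
  completedᵇ sx sy tx ty exy gxy =
    if sx ∧ sy ∧ not exy then true
    else if (sx ∧ not (ty ∨ sy)) ∨ (sy ∧ not (tx ∨ sx)) then false
    else gxy

  triangleᵇ : Bool → Bool → Bool → Bool
  triangleᵇ a b c = a ∧ b ∧ c

  cherryᵇ : Bool → Bool → Bool → Bool
  cherryᵇ a b c = (a ∧ b ∧ not c) ∨ (a ∧ not b ∧ c) ∨ (not a ∧ b ∧ c)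

  nonAdjacentᵇ-comm : ∀ sx sy e g → nonAdjacentᵇ sy sx e g ≡ nonAdjacentᵇ sx sy e g
  nonAdjacentᵇ-comm sx sy e g = ⌊⌋-witness (_ Bool.≟ _)
    (checkAll-sound 4 (sameᵇ 4 (λ sx sy → nonAdjacentᵇ sy sx) nonAdjacentᵇ) refl sx sy e g)

  completedᵇ-comm : ∀ sx sy tx ty e g → completedᵇ sy sx ty tx e g ≡ completedᵇ sx sy tx ty e g
  completedᵇ-comm sx sy tx ty e g = ⌊⌋-witness (_ Bool.≟ _)
    (checkAll-sound 6 (sameᵇ 6 (λ sx sy tx ty → completedᵇ sy sx ty tx) completedᵇ) refl sx sy tx ty e g)

  SymmetricFunctionᵇ : (Bool → Bool → Bool → Bool) → Set
  SymmetricFunctionᵇ f = (∀ a b c → f b a c ≡ f a b c) × (∀ a b c → f a c b ≡ f a b c)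

  symmetricFunctionᵇ : ∀ f → checkAll 3 (sameᵇ 3 (λ a b c → f b a c) f) ≡ true →
                       checkAll 3 (sameᵇ 3 (λ a b c → f a c b) f) ≡ true → SymmetricFunctionᵇ f
  symmetricFunctionᵇ f swap₁₂ swap₂₃ =
    (λ a b c → ⌊⌋-witness (_ Bool.≟ _) (checkAll-sound 3 (sameᵇ 3 (λ a b c → f b a c) f) swap₁₂ a b c)) ,
    (λ a b c → ⌊⌋-witness (_ Bool.≟ _) (checkAll-sound 3 (sameᵇ 3 (λ a b c → f a c b) f) swap₂₃ a b c))

  triangleᵇ-symmetric : SymmetricFunctionᵇ triangleᵇ
  triangleᵇ-symmetric = symmetricFunctionᵇ triangleᵇ refl refl

  cherryᵇ-symmetric : SymmetricFunctionᵇ cherryᵇ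
  cherryᵇ-symmetric = symmetricFunctionᵇ cherryᵇ refl refl

  edgePattern-symmetric : ∀ {n} (f : Bool → Bool → Bool → Bool) → SymmetricFunctionᵇ f →
    {H : Fin n → Fin n → Bool} → Symmetric₂ H → Symmetric₃ (λ i j k → f (H i j) (H i k) (H j k))
  edgePattern-symmetric f (f₁₂ , f₂₃) {H} H-sym =
    (λ i j k → trans (cong (λ x → f x (H j k) (H i k)) (H-sym i j)) (f₂₃ (H i j) (H i k) (H j k))) ,
    (λ i j k → trans (cong (f (H i k) (H i j)) (H-sym j k)) (f₁₂ (H i j) (H i k) (H j k)))

  Σ≠-edgePattern : ∀ {n} (f : Bool → Bool → Bool → Bool) → SymmetricFunctionᵇ f →
    {H : Fin n → Fin n → Bool} → Symmetric₂ H →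
    Σ≠ (λ i j k → b2n (f (H i j) (H i k) (H j k))) ≡ 6 * count3 (λ i j k → f (H i j) (H i k) (H j k))
  Σ≠-edgePattern f f-sym H-sym = Σ≠-count3 _ (edgePattern-symmetric f f-sym H-sym)

  Σ≠-edgePattern-cong : ∀ {n} (f : Bool → Bool → Bool → Bool) {H H′ : Fin n → Fin n → Bool} →
    (∀ {x y} → x ≢ y → H x y ≡ H′ x y) →
    Σ≠ (λ i j k → b2n (f (H i j) (H i k) (H j k))) ≡ Σ≠ (λ i j k → b2n (f (H′ i j) (H′ i k) (H′ j k)))
  Σ≠-edgePattern-cong f {H} {H′} H≡H′ = Σ≠-cong pointwise
    where
    pointwise : ∀ i j k → distinct i j k ≡ true →
                b2n (f (H i j) (H i k) (H j k)) ≡ b2n (f (H′ i j) (H′ i k) (H′ j k))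
    pointwise i j k d with distinct-elim i j k d
    ... | i≢j , i≢k , j≢k rewrite H≡H′ i≢j | H≡H′ i≢k | H≡H′ j≢k = refl

  -- Constraints that a tight clique T with common neighbourhood S imposes on a pair x, y:
  -- T and S are disjoint, S is complete to T, and neighbours of T lie in T ∪ S.
  clusterPairᵇ : (tx ty sx sy gxy : Bool) → Bool
  clusterPairᵇ tx ty sx sy gxy =
    not (tx ∧ sx) ∧ not (ty ∧ sy) ∧ ((sx ∧ ty) ⇒ᵇ gxy) ∧ ((tx ∧ sy) ⇒ᵇ gxy) ∧
    ((tx ∧ gxy) ⇒ᵇ (ty ∨ sy)) ∧ ((ty ∧ gxy) ⇒ᵇ (tx ∨ sx))

  clusterTripleᵇ : (tᵢ tⱼ tₖ sᵢ sⱼ sₖ gᵢⱼ gᵢₖ gⱼₖ : Bool) → Bool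
  clusterTripleᵇ tᵢ tⱼ tₖ sᵢ sⱼ sₖ gᵢⱼ gᵢₖ gⱼₖ =
    clusterPairᵇ tᵢ tⱼ sᵢ sⱼ gᵢⱼ ∧ clusterPairᵇ tᵢ tₖ sᵢ sₖ gᵢₖ ∧ clusterPairᵇ tⱼ tₖ sⱼ sₖ gⱼₖ

  lostᵇ : (tᵢ tⱼ tₖ sᵢ sⱼ sₖ gᵢⱼ gᵢₖ gⱼₖ : Bool) → Bool
  lostᵇ tᵢ tⱼ tₖ sᵢ sⱼ sₖ gᵢⱼ gᵢₖ gⱼₖ =
    triangleᵇ gᵢⱼ gᵢₖ gⱼₖ ∧
    not (triangleᵇ (completedᵇ sᵢ sⱼ tᵢ tⱼ false gᵢⱼ) (completedᵇ sᵢ sₖ tᵢ tₖ false gᵢₖ)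
                   (completedᵇ sⱼ sₖ tⱼ tₖ false gⱼₖ))

  wedgeᵇ : (sa gab tb sb gac tc : Bool) → Bool
  wedgeᵇ sa gab tb sb gac tc = (sa ∧ (gab ∧ not tb ∧ not sb)) ∧ (gac ∧ not tc)

  -- For three distinct vertices: a triangle of G survives in G_T or is lost; if i ∈ T and jk ∈ R then
  -- ijk is a new triangle of G_T; and a triple inside S spanning k ≥ 1 edges of R is a triangle of
  -- G_T, while k ≤ 1 + 2·[k = 3] + [k = 2].
  gainᵇ : BoolPred 9
  gainᵇ tᵢ tⱼ tₖ sᵢ sⱼ sₖ gᵢⱼ gᵢₖ gⱼₖ = clusterTripleᵇ tᵢ tⱼ tₖ sᵢ sⱼ sₖ gᵢⱼ gᵢₖ gⱼₖ ⇒ᵇ (before ≤ᵇ after)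
    where
    rᵢⱼ rᵢₖ rⱼₖ : Bool
    rᵢⱼ = nonAdjacentᵇ sᵢ sⱼ false gᵢⱼ
    rᵢₖ = nonAdjacentᵇ sᵢ sₖ false gᵢₖ
    rⱼₖ = nonAdjacentᵇ sⱼ sₖ false gⱼₖ
    before after : ℕ
    before = b2n (triangleᵇ gᵢⱼ gᵢₖ gⱼₖ)
           + (b2n (tᵢ ∧ rⱼₖ) + b2n (tⱼ ∧ rᵢₖ) + b2n (tₖ ∧ rᵢⱼ))
           + (b2n (rⱼₖ ∧ sᵢ) + b2n (rᵢₖ ∧ sⱼ) + b2n (rᵢⱼ ∧ sₖ))
    after  = b2n (triangleᵇ (completedᵇ sᵢ sⱼ tᵢ tⱼ false gᵢⱼ) (completedᵇ sᵢ sₖ tᵢ tₖ false gᵢₖ)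
                            (completedᵇ sⱼ sₖ tⱼ tₖ false gⱼₖ))
           + b2n (triangleᵇ rᵢⱼ rᵢₖ rⱼₖ) + b2n (triangleᵇ rᵢⱼ rᵢₖ rⱼₖ) + b2n (cherryᵇ rᵢⱼ rᵢₖ rⱼₖ)
           + b2n (lostᵇ tᵢ tⱼ tₖ sᵢ sⱼ sₖ gᵢⱼ gᵢₖ gⱼₖ)

  -- A lost triangle abc has a ∈ S and b ∉ T ∪ S; then c ∉ T, and besides the wedge (a, b, c) it
  -- contains the wedge (c, b, a) if c ∈ S and (a, c, b) otherwise.
  lossᵇ : BoolPred 9
  lossᵇ tᵢ tⱼ tₖ sᵢ sⱼ sₖ gᵢⱼ gᵢₖ gⱼₖ =
    clusterTripleᵇ tᵢ tⱼ tₖ sᵢ sⱼ sₖ gᵢⱼ gᵢₖ gⱼₖ ⇒ᵇ (lost + lost ≤ᵇ wedges)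
    where
    lost wedges : ℕ
    lost   = b2n (lostᵇ tᵢ tⱼ tₖ sᵢ sⱼ sₖ gᵢⱼ gᵢₖ gⱼₖ)
    wedges = (b2n (wedgeᵇ sᵢ gᵢⱼ tⱼ sⱼ gᵢₖ tₖ) + b2n (wedgeᵇ sⱼ gᵢⱼ tᵢ sᵢ gⱼₖ tₖ)
              + b2n (wedgeᵇ sₖ gᵢₖ tᵢ sᵢ gⱼₖ tⱼ))
           + (b2n (wedgeᵇ sᵢ gᵢₖ tₖ sₖ gᵢⱼ tⱼ) + b2n (wedgeᵇ sⱼ gⱼₖ tₖ sₖ gᵢⱼ tᵢ)
              + b2n (wedgeᵇ sₖ gⱼₖ tⱼ sⱼ gᵢₖ tᵢ))

module CommonNeighbourhood {n : ℕ} (G : Adj n) (T : VSet n) where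

  open BooleanChecks using (⇒ᵇ-intro)

  commonNbhd-adjacent : ∀ {v y} → commonNbhd G T v ≡ true → T y ≡ true → G y v ≡ true
  commonNbhd-adjacent {v} {y} v∈S y∈T = Equivalence.to T-≡ (subst (λ b → True (not b ∨ G y v)) y∈T
    (tabulate⁻ (all⁺ (λ y → not (T y) ∨ G y v) (allFin n) (Equivalence.from T-≡ v∈S)) y))

  commonNbhd-intro : ∀ {v} → (∀ y → T y ≡ true → G y v ≡ true) → commonNbhd G T v ≡ true
  commonNbhd-intro {v} adjacent = Equivalence.to T-≡ (all⁻ (λ y → not (T y) ∨ G y v)
    (tabulate⁺ λ y → Equivalence.from T-≡ (⇒ᵇ-intro (adjacent y))))

module AroundCluster {n r : ℕ} (G : Adj n) (simple : IsSimpleGraph G) (Δ≤r : MaxDegreeLe G r) (1≤r : 1 ≤ r)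
                     (T : VSet n) (tight : TightClique G r T) (2≤t : 2 ≤ card T) where

  open import Data.Nat using (_+_; _*_)
  open import Data.Nat.Tactic.RingSolver using (solve-∀)

  open BooleanChecks
  open FiniteSums
  open TripleConfigurations
  open CommonNeighbourhood G T

  S : VSet n
  S = commonNbhd G T

  R Rˡ Gᵀ Gᵀˡ : Adj n
  R = Rgraph G S
  Gᵀ = GT G T
  Rˡ x y = nonAdjacentᵇ (S x) (S y) false (G x y)
  Gᵀˡ x y = completedᵇ (S x) (S y) (T x) (T y) false (G x y)

  t m : ℕ
  t = card T
  m = card S

  G-sym : Symmetric₂ G
  G-sym x y = proj₁ simple y x

  G-irrefl : ∀ x → G x x ≡ false
  G-irrefl = proj₂ simple

  degree≤r : ∀ x → ∑[ v < n ] b2n (G x v) ≤ r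
  degree≤r x = subst (_≤ r) (card≡∑ (G x)) (Δ≤r x)

  S-adjacent : ∀ {v y} → S v ≡ true → T y ≡ true → G v y ≡ true
  S-adjacent v∈S y∈T = trans (G-sym _ _) (commonNbhd-adjacent v∈S y∈T)

  T∩S=∅ : ∀ {x} → T x ≡ true → S x ≡ false
  T∩S=∅ {x} x∈T with S x in x∈S
  ... | false = refl
  ... | true  = contradiction (trans (sym (G-irrefl x)) (S-adjacent x∈S x∈T)) λ ()

  S∩T=∅ : ∀ {x} → S x ≡ true → T x ≡ false
  S∩T=∅ {x} x∈S with T x in x∈T
  ... | false = refl
  ... | true  = contradiction (trans (sym (T∩S=∅ x∈T)) x∈S) λ ()

  R-sym : Symmetric₂ R
  R-sym x y = trans (cong₂ (nonAdjacentᵇ (S y) (S x)) (⌊≟⌋-sym y x) (G-sym x y))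
                    (nonAdjacentᵇ-comm (S x) (S y) ⌊ x ≟ y ⌋ (G x y))

  Gᵀ-sym : Symmetric₂ Gᵀ
  Gᵀ-sym x y = trans (cong₂ (completedᵇ (S y) (S x) (T y) (T x)) (⌊≟⌋-sym y x) (G-sym x y))
                     (completedᵇ-comm (S x) (S y) (T x) (T y) ⌊ x ≟ y ⌋ (G x y))

  R-irrefl : ∀ x → R x x ≡ false
  R-irrefl x rewrite ⌊⌋-true (x ≟ x) refl | ∧-zeroʳ (S x) | ∧-zeroʳ (S x) = refl

  R-local : ∀ {x y} → x ≢ y → R x y ≡ Rˡ x y
  R-local {x} {y} x≢y = cong (λ e → nonAdjacentᵇ (S x) (S y) e (G x y)) (⌊⌋-false (x ≟ y) x≢y)

  Gᵀ-local : ∀ {x y} → x ≢ y → Gᵀ x y ≡ Gᵀˡ x y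
  Gᵀ-local {x} {y} x≢y = cong (λ e → completedᵇ (S x) (S y) (T x) (T y) e (G x y)) (⌊⌋-false (x ≟ y) x≢y)

  R-elim : ∀ {x y} → R x y ≡ true → S x ≡ true × S y ≡ true × x ≢ y
  R-elim {x} {y} Rxy =
    let x∈S , rest = ∧-elim Rxy
        y∈S , rest′ = ∧-elim {S y} rest
        x≠y , _ = ∧-elim {not ⌊ x ≟ y ⌋} rest′
    in x∈S , y∈S , ⌊⌋-refutation (x ≟ y) (not-true x≠y)

  -- |N(x) ∩ N(y)| = r − 1 for the tight edge xy; two further points bring the count to r + 1.
  tight-edge+2 : ∀ {x y} → T x ≡ true → T y ≡ true → x ≢ y → (a b : Fin n) (g : Fin n → ℕ) →
    (∀ v → b2n (G x v ∧ G y v) + b2n ⌊ v ≟ a ⌋ + b2n ⌊ v ≟ b ⌋ ≤ g v) → suc r ≤ sum g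
  tight-edge+2 {x} {y} x∈T y∈T x≢y a b g bound = begin
    suc r
      ≡⟨ +-comm 1 r ⟩
    r + 1
      ≡⟨ cong (_+ 1) (m∸n+n≡m 1≤r) ⟨
    r ∸ 1 + 1 + 1
      ≡⟨ cong (λ c → c + 1 + 1) (trans (sym (proj₂ (tight x y x∈T y∈T x≢y))) (card≡∑ λ v → G x v ∧ G y v)) ⟩
    sum common + 1 + 1
      ≡⟨ cong (_+ 1) (∑-+-indicator common a) ⟨
    ∑[ v < n ] (common v + b2n ⌊ v ≟ a ⌋) + 1
      ≡⟨ ∑-+-indicator (λ v → common v + b2n ⌊ v ≟ a ⌋) b ⟨
    ∑[ v < n ] (common v + b2n ⌊ v ≟ a ⌋ + b2n ⌊ v ≟ b ⌋)
      ≤⟨ ∑-mono-≤ bound ⟩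
    sum g ∎
    where
    open ≤-Reasoning
    common : Fin n → ℕ
    common v = b2n (G x v ∧ G y v)

  tight-neighbour : ∀ {x y z} → T x ≡ true → T y ≡ true → x ≢ y → G x z ≡ true → z ≢ y → G y z ≡ true
  tight-neighbour {x} {y} {z} x∈T y∈T x≢y xz z≢y with G y z in yz
  ... | true  = refl
  ... | false =
    contradiction (≤-trans (tight-edge+2 x∈T y∈T x≢y y z (λ v → b2n (G x v)) pointwise) (degree≤r x)) 1+n≰n
    where
    pointwise : ∀ v → b2n (G x v ∧ G y v) + b2n ⌊ v ≟ y ⌋ + b2n ⌊ v ≟ z ⌋ ≤ b2n (G x v)
    pointwise v with v ≟ y | v ≟ z
    ... | yes v≡y | yes v≡z = contradiction (trans (sym v≡z) v≡y) z≢y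
    ... | yes v≡y | no _    rewrite v≡y | G-irrefl y | proj₁ (tight x y x∈T y∈T x≢y) = s≤s z≤n
    ... | no _    | yes v≡z rewrite v≡z | xz | yz = s≤s z≤n
    ... | no _    | no _    rewrite +-identityʳ (b2n (G x v ∧ G y v)) | +-identityʳ (b2n (G x v ∧ G y v)) =
      b2n-∧-≤ˡ (G x v) (G y v)

  T-neighbour : ∀ {x z} → T x ≡ true → G x z ≡ true → T z ∨ S z ≡ true
  T-neighbour {x} {z} x∈T xz with T z in z∈T
  ... | true  = refl
  ... | false = commonNbhd-intro adjacent
    where
    adjacent : ∀ y → T y ≡ true → G y z ≡ true
    adjacent y y∈T with x ≟ y
    ... | yes refl = xz
    ... | no  x≢y  = tight-neighbour x∈T y∈T x≢y xz λ z≡y →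
      contradiction (trans (sym z∈T) (trans (cong T z≡y) y∈T)) λ ()

  -- Two vertices of T together with their r − 1 common neighbours all lie in T ∪ S.
  size-bound : suc r ≤ t + m
  size-bound with member T (≤-trans (s≤s z≤n) 2≤t)
  ... | x₀ , x₀∈T with other-member T x₀ 2≤t
  ...   | y₀ , y₀∈T , x₀≢y₀ = begin
    suc r
      ≤⟨ tight-edge+2 x₀∈T y₀∈T x₀≢y₀ x₀ y₀ (λ v → b2n (T v) + b2n (S v)) pointwise ⟩
    ∑[ v < n ] (b2n (T v) + b2n (S v))
      ≡⟨ ∑-distrib-+ (λ v → b2n (T v)) (λ v → b2n (S v)) ⟩
    ∑[ v < n ] b2n (T v) + ∑[ v < n ] b2n (S v)
      ≡⟨ cong₂ _+_ (card≡∑ T) (card≡∑ S) ⟨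
    t + m ∎
    where
    open ≤-Reasoning
    pointwise : ∀ v → b2n (G x₀ v ∧ G y₀ v) + b2n ⌊ v ≟ x₀ ⌋ + b2n ⌊ v ≟ y₀ ⌋ ≤ b2n (T v) + b2n (S v)
    pointwise v with v ≟ x₀ | v ≟ y₀
    ... | yes v≡x₀ | yes v≡y₀ = contradiction (trans (sym v≡x₀) v≡y₀) x₀≢y₀
    ... | yes v≡x₀ | no _     rewrite v≡x₀ | G-irrefl x₀ | x₀∈T | T∩S=∅ x₀∈T = s≤s z≤n
    ... | no _     | yes v≡y₀ rewrite v≡y₀ | G-irrefl y₀ | ∧-zeroʳ (G x₀ y₀) | y₀∈T | T∩S=∅ y₀∈T = s≤s z≤n
    ... | no _     | no _     with G x₀ v ∧ G y₀ v in common
    ...   | false = z≤n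
    ...   | true  = b2n-∨ (T v) (S v) (T-neighbour x₀∈T (proj₁ (∧-elim common)))

  outer : Fin n → Fin n → Bool
  outer x y = G x y ∧ not (T y) ∧ not (S y)

  -- For s ∈ S: deg s = |T| + (|S| − 1 − deg_R s) + #outer neighbours ≤ r < |T| + |S|.
  outer-degree-≤ : ∀ {s} → S s ≡ true → ∑[ j < n ] b2n (outer s j) ≤ ∑[ j < n ] b2n (R s j)
  outer-degree-≤ {s} s∈S = +-cancelʳ-≤ (t + m) (sum outerₛ) (sum Rₛ) (begin
    sum outerₛ + (t + m)
      ≡⟨ cong (sum outerₛ +_) (cong₂ _+_ (card≡∑ T) (card≡∑ S)) ⟩
    sum outerₛ + (sum Tᵥ + sum Sᵥ)
      ≡⟨ +-assoc (sum outerₛ) (sum Tᵥ) (sum Sᵥ) ⟨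
    sum outerₛ + sum Tᵥ + sum Sᵥ
      ≡⟨ trans (∑-distrib-+ _ Sᵥ) (cong (_+ sum Sᵥ) (∑-distrib-+ outerₛ Tᵥ)) ⟨
    ∑[ j < n ] (outerₛ j + Tᵥ j + Sᵥ j)
      ≤⟨ ∑-mono-≤ pointwise ⟩
    ∑[ j < n ] (Gₛ j + Rₛ j + b2n ⌊ j ≟ s ⌋)
      ≡⟨ trans (∑-+-indicator (λ j → Gₛ j + Rₛ j) s) (cong (_+ 1) (∑-distrib-+ Gₛ Rₛ)) ⟩
    sum Gₛ + sum Rₛ + 1
      ≤⟨ +-monoˡ-≤ 1 (+-monoˡ-≤ (sum Rₛ) (degree≤r s)) ⟩
    r + sum Rₛ + 1
      ≡⟨ rearrange r (sum Rₛ) ⟩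
    sum Rₛ + suc r
      ≤⟨ +-monoʳ-≤ (sum Rₛ) size-bound ⟩
    sum Rₛ + (t + m) ∎)
    where
    open ≤-Reasoning
    outerₛ Rₛ Gₛ Tᵥ Sᵥ : Fin n → ℕ
    outerₛ j = b2n (outer s j)
    Rₛ j = b2n (R s j)
    Gₛ j = b2n (G s j)
    Tᵥ j = b2n (T j)
    Sᵥ j = b2n (S j)
    rearrange : ∀ a b → a + b + 1 ≡ b + suc a
    rearrange = solve-∀
    pointwise : ∀ j → outerₛ j + Tᵥ j + Sᵥ j ≤ Gₛ j + Rₛ j + b2n ⌊ j ≟ s ⌋
    pointwise j with j ≟ s
    ... | yes j≡s rewrite j≡s | G-irrefl s | S∩T=∅ s∈S | s∈S = m≤n+m 1 _
    ... | no  j≢s rewrite s∈S | ⌊⌋-false (s ≟ j) (j≢s ∘ sym) with T j in j∈T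
    ...   | true  rewrite T∩S=∅ j∈T | S-adjacent s∈S j∈T = s≤s z≤n
    ...   | false with S j | G s j
    ...     | true  | true  = s≤s z≤n
    ...     | true  | false = s≤s z≤n
    ...     | false | true  = s≤s z≤n
    ...     | false | false = z≤n

  -- For s ∈ S and an outer neighbour j, s has at most r − |T| − 1 ≤ |S| − 2 neighbours outside T
  -- other than j.
  nonT-neighbours-≤ : ∀ {s j} → S s ≡ true → outer s j ≡ true →
                      ∑[ k < n ] b2n (not ⌊ j ≟ k ⌋ ∧ (G s k ∧ not (T k))) ≤ m ∸ 2
  nonT-neighbours-≤ {s} {j} s∈S sj-outer = m+n≤o⇒m≤o∸n A (+-cancelʳ-≤ t (A + 2) m (begin
    A + 2 + t
      ≡⟨ rearrange A t ⟩
    suc (A + 1 + t)                                  ≤⟨ s≤s (begin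
      A + 1 + t
        ≡⟨ cong (_+ t) (∑-+-indicator others j) ⟨
      ∑[ k < n ] (others k + b2n ⌊ k ≟ j ⌋) + t
        ≡⟨ cong (∑[ k < n ] (others k + b2n ⌊ k ≟ j ⌋) +_) (card≡∑ T) ⟩
      ∑[ k < n ] (others k + b2n ⌊ k ≟ j ⌋) + ∑[ k < n ] b2n (T k)
        ≡⟨ ∑-distrib-+ (λ k → others k + b2n ⌊ k ≟ j ⌋) (λ k → b2n (T k)) ⟨
      ∑[ k < n ] (others k + b2n ⌊ k ≟ j ⌋ + b2n (T k))
        ≤⟨ ∑-mono-≤ pointwise ⟩
      ∑[ k < n ] b2n (G s k)
        ≤⟨ degree≤r s ⟩
      r ∎) ⟩
    suc r
      ≤⟨ size-bound ⟩
    t + m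
      ≡⟨ +-comm t m ⟩
    m + t ∎))
    where
    open ≤-Reasoning
    others : Fin n → ℕ
    others k = b2n (not ⌊ j ≟ k ⌋ ∧ (G s k ∧ not (T k)))
    A : ℕ
    A = sum others
    rearrange : ∀ a b → a + 2 + b ≡ suc (a + 1 + b)
    rearrange = solve-∀
    sj : G s j ≡ true
    sj = proj₁ (∧-elim sj-outer)
    j∉T : T j ≡ false
    j∉T = not-true (proj₁ (∧-elim (proj₂ (∧-elim {G s j} sj-outer))))
    pointwise : ∀ k → others k + b2n ⌊ k ≟ j ⌋ + b2n (T k) ≤ b2n (G s k)
    pointwise k rewrite ⌊≟⌋-sym j k with k ≟ j
    ... | yes k≡j rewrite k≡j | sj | j∉T = s≤s z≤n
    ... | no  _   with T k in k∈T
    ...   | true  rewrite S-adjacent s∈S k∈T = s≤s z≤n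
    ...   | false with G s k
    ...     | true  = s≤s z≤n
    ...     | false = z≤n

  T-S-distinct : ∀ {x y} → T x ≡ true → S y ≡ true → x ≢ y
  T-S-distinct x∈T y∈S refl = contradiction (trans (sym (T∩S=∅ x∈T)) y∈S) λ ()

  cluster-pair : ∀ x y → clusterPairᵇ (T x) (T y) (S x) (S y) (G x y) ≡ true
  cluster-pair x y =
    ∧-intro (T-not-S x) (∧-intro (T-not-S y) (∧-intro
      (⇒ᵇ-intro λ h → S-adjacent (proj₁ (∧-elim h)) (proj₂ (∧-elim {S x} h))) (∧-intro
      (⇒ᵇ-intro λ h → trans (sym (G-sym x y)) (S-adjacent (proj₂ (∧-elim {T x} h)) (proj₁ (∧-elim h))))
      (∧-intro
      (⇒ᵇ-intro λ h → T-neighbour (proj₁ (∧-elim h)) (proj₂ (∧-elim {T x} h)))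
      (⇒ᵇ-intro λ h → T-neighbour (proj₁ (∧-elim h)) (trans (sym (G-sym y x)) (proj₂ (∧-elim {T y} h))))))))
    where
    T-not-S : ∀ x → not (T x ∧ S x) ≡ true
    T-not-S x with T x in x∈T
    ... | false = refl
    ... | true  rewrite T∩S=∅ x∈T = refl

  cluster-triple : ∀ i j k →
    clusterTripleᵇ (T i) (T j) (T k) (S i) (S j) (S k) (G i j) (G i k) (G j k) ≡ true
  cluster-triple i j k = ∧-intro (cluster-pair i j) (∧-intro (cluster-pair i k) (cluster-pair j k))

  -- viaT i j k: ijk is a new triangle through i ∈ T;  viaS i j k: jk ∈ R and i ∈ S.
  viaT viaS lost wedge : Fin n → Fin n → Fin n → ℕ
  viaT i j k = b2n (T i ∧ Rˡ j k)
  viaS i j k = b2n (Rˡ j k ∧ S i)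
  lost i j k = b2n (lostᵇ (T i) (T j) (T k) (S i) (S j) (S k) (G i j) (G i k) (G j k))
  wedge a b c = b2n (wedgeᵇ (S a) (G a b) (T b) (S b) (G a c) (T c))

  wedges-≤ : Σ≠ wedge ≤ ∑[ a < n ] ∑[ b < n ] (b2n (S a ∧ outer a b) * (m ∸ 2))
  wedges-≤ = begin
    Σ≠ wedge
      ≤⟨ Σ₃-mono-≤ pointwise ⟩
    Σ₃ (λ a b c → b2n (S a ∧ outer a b) * others a b c)
      ≡⟨ sum-cong-≗ (λ a → sum-cong-≗ λ b → *-distribˡ-sum (b2n (S a ∧ outer a b)) (others a b)) ⟨
    ∑[ a < n ] ∑[ b < n ] (b2n (S a ∧ outer a b) * sum (others a b))
      ≤⟨ ∑-mono-≤ (λ a → ∑-mono-≤ λ b → bounded a b) ⟩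
    ∑[ a < n ] ∑[ b < n ] (b2n (S a ∧ outer a b) * (m ∸ 2)) ∎
    where
    open ≤-Reasoning
    others : Fin n → Fin n → Fin n → ℕ
    others a b c = b2n (not ⌊ b ≟ c ⌋ ∧ (G a c ∧ not (T c)))
    pointwise : ∀ a b c → b2n (distinct a b c) * wedge a b c ≤ b2n (S a ∧ outer a b) * others a b c
    pointwise a b c with distinct a b c in d
    ... | false = z≤n
    ... | true rewrite ⌊⌋-false (b ≟ c) (proj₂ (proj₂ (distinct-elim a b c d))) =
      ≤-reflexive (trans (+-identityʳ _) (b2n-∧ (S a ∧ outer a b) (G a c ∧ not (T c))))
    bounded : ∀ a b → b2n (S a ∧ outer a b) * sum (others a b) ≤ b2n (S a ∧ outer a b) * (m ∸ 2)
    bounded a b with S a ∧ outer a b in e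
    ... | false = z≤n
    ... | true  = +-monoˡ-≤ 0 (nonT-neighbours-≤ (proj₁ (∧-elim e)) (proj₂ (∧-elim {S a} e)))

  outer-edges-≤ : ∑[ a < n ] ∑[ b < n ] (b2n (S a ∧ outer a b) * (m ∸ 2)) ≤ Σ≠ (λ a b c → b2n (R a b ∧ S c))
  outer-edges-≤ = begin
    ∑[ a < n ] ∑[ b < n ] (b2n (S a ∧ outer a b) * (m ∸ 2))
      ≡⟨ sum-cong-≗ (λ a → *-distribʳ-sum (m ∸ 2) λ b → b2n (S a ∧ outer a b)) ⟨
    ∑[ a < n ] (∑[ b < n ] b2n (S a ∧ outer a b) * (m ∸ 2))
      ≤⟨ ∑-mono-≤ degrees ⟩
    ∑[ a < n ] (∑[ b < n ] b2n (R a b) * (m ∸ 2))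
      ≡⟨ sum-cong-≗ (λ a → *-distribʳ-sum (m ∸ 2) λ b → b2n (R a b)) ⟩
    ∑[ a < n ] ∑[ b < n ] (b2n (R a b) * (m ∸ 2))
      ≤⟨ ∑-mono-≤ (λ a → ∑-mono-≤ λ b → thirdVertices a b) ⟩
    Σ≠ (λ a b c → b2n (R a b ∧ S c)) ∎
    where
    open ≤-Reasoning
    degrees : ∀ a → ∑[ b < n ] b2n (S a ∧ outer a b) * (m ∸ 2) ≤ ∑[ b < n ] b2n (R a b) * (m ∸ 2)
    degrees a = *-monoˡ-≤ (m ∸ 2) (begin
      ∑[ b < n ] b2n (S a ∧ outer a b)        ≡⟨ sum-cong-≗ (λ b → b2n-∧ (S a) (outer a b)) ⟩
      ∑[ b < n ] (b2n (S a) * b2n (outer a b)) ≡⟨ *-distribˡ-sum (b2n (S a)) (λ b → b2n (outer a b)) ⟨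
      b2n (S a) * ∑[ b < n ] b2n (outer a b)   ≤⟨ b2n-*-≤ (S a) outer-degree-≤ ⟩
      ∑[ b < n ] b2n (R a b) ∎)
    thirdVertices : ∀ a b → b2n (R a b) * (m ∸ 2) ≤ ∑[ c < n ] (b2n (distinct a b c) * b2n (R a b ∧ S c))
    thirdVertices a b with R a b in ab
    ... | false = z≤n
    ... | true  = ≤-trans (≤-reflexive (+-identityʳ (m ∸ 2))) (∑-distinct-≥ S (proj₂ (proj₂ (R-elim ab))))

  wedges-≤-viaS : Σ≠ wedge ≤ Σ≠ viaS
  wedges-≤-viaS = begin
    Σ≠ wedge
      ≤⟨ ≤-trans wedges-≤ outer-edges-≤ ⟩
    Σ≠ (λ a b c → b2n (R a b ∧ S c))
      ≡⟨ Σ≠-cong (λ a b c d → cong (λ x → b2n (x ∧ S c)) (R-local (proj₁ (distinct-elim a b c d)))) ⟩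
    Σ≠ (λ a b c → viaS c a b)
      ≡⟨ Σ≠-Invariance.rotate² viaS ⟩
    Σ≠ viaS ∎
    where open ≤-Reasoning

  lost-pointwise : ∀ i j k → lost i j k + lost i j k ≤
    (wedge i j k + wedge j i k + wedge k i j) + (wedge i k j + wedge j k i + wedge k j i)
  lost-pointwise i j k rewrite G-sym i j | G-sym i k | G-sym j k =
    ≤ᵇ-sound (⇒ᵇ-elim (checkAll-sound 9 lossᵇ refl (T i) (T j) (T k) (S i) (S j) (S k)
                                                   (G i j) (G i k) (G j k))
                      (cluster-triple i j k))

  lost-≤ : Σ≠ lost ≤ 3 * Σ≠ viaS
  lost-≤ = *-cancelˡ-≤ 2 (begin
    2 * Σ≠ lost                        ≡⟨ cong (Σ≠ lost +_) (+-identityʳ (Σ≠ lost)) ⟩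
    Σ≠ lost + Σ≠ lost                  ≡⟨ Σ≠-distrib-+ lost lost ⟨
    Σ≠ (λ i j k → lost i j k + lost i j k) ≤⟨ Σ≠-mono-≤ lost-pointwise ⟩
    Σ≠ (λ i j k → (wedge i j k + wedge j i k + wedge k i j) + (wedge i k j + wedge j k i + wedge k j i))
                                       ≡⟨ Σ≠-Invariance.orbit₆ wedge ⟩
    6 * Σ≠ wedge                       ≤⟨ *-monoʳ-≤ 6 wedges-≤-viaS ⟩
    6 * Σ≠ viaS                        ≡⟨ *-assoc 2 3 (Σ≠ viaS) ⟩
    2 * (3 * Σ≠ viaS) ∎)
    where open ≤-Reasoning

  Σ≠-viaT : Σ≠ viaT ≡ t * (2 * eR R)
  Σ≠-viaT = begin
    Σ≠ viaT
      ≡⟨ Σ≠-cong (λ i j k d → cong (λ x → b2n (T i ∧ x)) (R-local (proj₂ (proj₂ (distinct-elim i j k d))))) ⟨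
    Σ≠ (λ i j k → b2n (T i ∧ R j k))
      ≡⟨ Σ₃-cong pointwise ⟩
    Σ₃ (λ i j k → b2n (T i) * b2n (R j k))
      ≡⟨ Σ₃-separate (λ i → b2n (T i)) (λ j k → b2n (R j k)) ⟩
    ∑[ i < n ] b2n (T i) * ∑[ j < n ] ∑[ k < n ] b2n (R j k)
      ≡⟨ cong₂ _*_ (sym (card≡∑ T)) (∑∑-count2 R R-sym R-irrefl) ⟩
    t * (2 * eR R) ∎
    where
    open ≡-Reasoning
    pointwise : ∀ i j k → b2n (distinct i j k) * b2n (T i ∧ R j k) ≡ b2n (T i) * b2n (R j k)
    pointwise i j k with T i in i∈T | R j k in jk
    ... | false | _     = *-zeroʳ (b2n (distinct i j k))
    ... | true  | false = *-zeroʳ (b2n (distinct i j k))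
    ... | true  | true  with R-elim jk
    ...   | j∈S , k∈S , j≢k rewrite distinct-intro (T-S-distinct i∈T j∈S) (T-S-distinct i∈T k∈S) j≢k = refl

  before after : Fin n → Fin n → Fin n → ℕ
  before i j k = b2n (triangleᵇ (G i j) (G i k) (G j k))
               + (viaT i j k + viaT j i k + viaT k i j) + (viaS i j k + viaS j i k + viaS k i j)
  after i j k = b2n (triangleᵇ (Gᵀˡ i j) (Gᵀˡ i k) (Gᵀˡ j k))
              + b2n (triangleᵇ (Rˡ i j) (Rˡ i k) (Rˡ j k)) + b2n (triangleᵇ (Rˡ i j) (Rˡ i k) (Rˡ j k))
              + b2n (cherryᵇ (Rˡ i j) (Rˡ i k) (Rˡ j k)) + lost i j k

  triangle-balance : ∀ i j k → before i j k ≤ after i j k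
  triangle-balance i j k =
    ≤ᵇ-sound (⇒ᵇ-elim (checkAll-sound 9 gainᵇ refl (T i) (T j) (T k) (S i) (S j) (S k)
                                                   (G i j) (G i k) (G j k))
                      (cluster-triple i j k))

  Σ≠-before : Σ≠ before ≡ 6 * k3 G + 3 * (t * (2 * eR R)) + 3 * Σ≠ viaS
  Σ≠-before = begin
    Σ≠ before
      ≡⟨ Σ≠-distrib-+ (λ i j k → triangleG i j k + viaT₃ i j k) viaS₃ ⟩
    Σ≠ (λ i j k → triangleG i j k + viaT₃ i j k) + Σ≠ viaS₃
      ≡⟨ cong (_+ Σ≠ viaS₃) (Σ≠-distrib-+ triangleG viaT₃) ⟩
    Σ≠ triangleG + Σ≠ viaT₃ + Σ≠ viaS₃
      ≡⟨ cong₂ _+_ (cong₂ _+_ (Σ≠-edgePattern triangleᵇ triangleᵇ-symmetric G-sym)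
                              (trans (Σ≠-Invariance.orbit₃ viaT) (cong (3 *_) Σ≠-viaT)))
                   (Σ≠-Invariance.orbit₃ viaS) ⟩
    6 * k3 G + 3 * (t * (2 * eR R)) + 3 * Σ≠ viaS ∎
    where
    open ≡-Reasoning
    triangleG viaT₃ viaS₃ : Fin n → Fin n → Fin n → ℕ
    triangleG i j k = b2n (triangleᵇ (G i j) (G i k) (G j k))
    viaT₃ i j k = viaT i j k + viaT j i k + viaT k i j
    viaS₃ i j k = viaS i j k + viaS j i k + viaS k i j

  Σ≠-after : Σ≠ after ≡ 6 * k3 Gᵀ + 6 * numK3 R + 6 * numK3 R + 6 * numP3 R + Σ≠ lost
  Σ≠-after = begin
    Σ≠ after
      ≡⟨ Σ≠-distrib-+ (λ i j k → GᵀRR i j k + cherryR i j k) lost ⟩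
    Σ≠ (λ i j k → GᵀRR i j k + cherryR i j k) + Σ≠ lost
      ≡⟨ cong (_+ Σ≠ lost) (Σ≠-distrib-+ GᵀRR cherryR) ⟩
    Σ≠ GᵀRR + Σ≠ cherryR + Σ≠ lost
      ≡⟨ cong (λ x → x + Σ≠ cherryR + Σ≠ lost) (Σ≠-distrib-+ GᵀR triangleR) ⟩
    Σ≠ GᵀR + Σ≠ triangleR + Σ≠ cherryR + Σ≠ lost
      ≡⟨ cong (λ x → x + Σ≠ triangleR + Σ≠ cherryR + Σ≠ lost) (Σ≠-distrib-+ triangleGᵀ triangleR) ⟩
    Σ≠ triangleGᵀ + Σ≠ triangleR + Σ≠ triangleR + Σ≠ cherryR + Σ≠ lost
      ≡⟨ cong (_+ Σ≠ lost) (cong₂ _+_ (cong₂ _+_ (cong₂ _+_ countGᵀ countK3) countK3) countP3) ⟩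
    6 * k3 Gᵀ + 6 * numK3 R + 6 * numK3 R + 6 * numP3 R + Σ≠ lost ∎
    where
    open ≡-Reasoning
    triangleGᵀ triangleR cherryR GᵀR GᵀRR : Fin n → Fin n → Fin n → ℕ
    triangleGᵀ i j k = b2n (triangleᵇ (Gᵀˡ i j) (Gᵀˡ i k) (Gᵀˡ j k))
    triangleR i j k = b2n (triangleᵇ (Rˡ i j) (Rˡ i k) (Rˡ j k))
    cherryR i j k = b2n (cherryᵇ (Rˡ i j) (Rˡ i k) (Rˡ j k))
    GᵀR i j k = triangleGᵀ i j k + triangleR i j k
    GᵀRR i j k = GᵀR i j k + triangleR i j k
    countGᵀ : Σ≠ triangleGᵀ ≡ 6 * k3 Gᵀ
    countGᵀ = trans (sym (Σ≠-edgePattern-cong triangleᵇ Gᵀ-local))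
                    (Σ≠-edgePattern triangleᵇ triangleᵇ-symmetric Gᵀ-sym)
    countK3 : Σ≠ triangleR ≡ 6 * numK3 R
    countK3 = trans (sym (Σ≠-edgePattern-cong triangleᵇ R-local))
                    (Σ≠-edgePattern triangleᵇ triangleᵇ-symmetric R-sym)
    countP3 : Σ≠ cherryR ≡ 6 * numP3 R
    countP3 = trans (sym (Σ≠-edgePattern-cong cherryᵇ R-local))
                    (Σ≠-edgePattern cherryᵇ cherryᵇ-symmetric R-sym)

  triangle-gain : k3 G + t * eR R ≤ k3 Gᵀ + 2 * numK3 R + numP3 R
  triangle-gain = *-cancelˡ-≤ 6 (+-cancelʳ-≤ (3 * Σ≠ viaS) _ _ (begin
    6 * (k3 G + t * eR R) + 3 * Σ≠ viaS
      ≡⟨ expand₁ (k3 G) t (eR R) (3 * Σ≠ viaS) ⟩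
    6 * k3 G + 3 * (t * (2 * eR R)) + 3 * Σ≠ viaS
      ≡⟨ Σ≠-before ⟨
    Σ≠ before
      ≤⟨ Σ≠-mono-≤ triangle-balance ⟩
    Σ≠ after
      ≡⟨ Σ≠-after ⟩
    6 * k3 Gᵀ + 6 * numK3 R + 6 * numK3 R + 6 * numP3 R + Σ≠ lost
      ≤⟨ +-monoʳ-≤ _ lost-≤ ⟩
    6 * k3 Gᵀ + 6 * numK3 R + 6 * numK3 R + 6 * numP3 R + 3 * Σ≠ viaS
      ≡⟨ expand₂ (k3 Gᵀ) (numK3 R) (numP3 R) (3 * Σ≠ viaS) ⟩
    6 * (k3 Gᵀ + 2 * numK3 R + numP3 R) + 3 * Σ≠ viaS ∎))
    where
    open ≤-Reasoning
    expand₁ : ∀ a b c d → 6 * (a + b * c) + d ≡ 6 * a + 3 * (b * (2 * c)) + d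
    expand₁ = solve-∀
    expand₂ : ∀ a b c d → 6 * a + 6 * b + 6 * b + 6 * c + d ≡ 6 * (a + 2 * b + c) + d
    expand₂ = solve-∀

open import Data.Integer as ℤ using (ℤ; +_; _-_; _*_; _≥_; 0ℤ; +≤+)
open import Data.Integer.Properties using (pos-+; pos-*; i≤j⇒i-j≤0; i-j≤0⇒i≤j)
open import Data.Integer.Tactic.RingSolver using (solve-∀)

difference-bound : ∀ a b c d e → a ℕ.+ b ≤ c ℕ.+ d ℕ.+ e → (+ c) - (+ a) ≥ (+ b) - (+ d) - (+ e)
difference-bound a b c d e h =
  i-j≤0⇒i≤j (subst (λ x → x ℤ.≤ 0ℤ) (sym rearranged) (i≤j⇒i-j≤0 (+≤+ h)))
  where
  regroup : ∀ (x y z u v : ℤ) → (y - u - v) - (z - x) ≡ (x ℤ.+ y) - (z ℤ.+ u ℤ.+ v)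
  regroup = solve-∀
  rearranged : ((+ b) - (+ d) - (+ e)) - ((+ c) - (+ a)) ≡ + (a ℕ.+ b) - + (c ℕ.+ d ℕ.+ e)
  rearranged rewrite pos-+ a b | pos-+ (c ℕ.+ d) e | pos-+ c d = regroup (+ a) (+ b) (+ c) (+ d) (+ e)

mainTheorem3 : (n r : ℕ) → 1 ≤ r → (G : Adj n) → IsSimpleGraph G → MaxDegreeLe G r →
    (T : VSet n) → Cluster G r T →
    (+ k3 (GT G T)) - (+ k3 G) ≥
      (+ card T) * (+ eR (Rgraph G (commonNbhd G T)))
        - (+ 2) * (+ numK3 (Rgraph G (commonNbhd G T)))
        - (+ numP3 (Rgraph G (commonNbhd G T)))
mainTheorem3 n r 1≤r G simple Δ≤r T (tight , 2≤t , _)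
  rewrite sym (pos-* (card T) (eR (Rgraph G (commonNbhd G T))))
        | sym (pos-* 2 (numK3 (Rgraph G (commonNbhd G T)))) =
  difference-bound (k3 G) (card T ℕ.* eR R) (k3 (GT G T)) (2 ℕ.* numK3 R) (numP3 R)
    (AroundCluster.triangle-gain G simple Δ≤r 1≤r T tight 2≤t)
  where
  R : Adj n
  R = Rgraph G (commonNbhd G T)
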